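{- (a) There exist infinitely many strongly connected digraphs $D$ with $\overrightarrow{trc}(D)=\overrightarrow{strc}(D)=\overrightarrow{rc}(D)=\overrightarrow{src}(D)=3$. (b) Given $s\ge 13$, there exists a strongly connected digraph $D$ with $\overrightarrow{trc}(D)=\overrightarrow{rvc}(D)=s$. (c) Given $s\ge 13$, there exists a strongly connected digraph $D$ with $\overrightarrow{strc}(D)=\overrightarrow{srvc}(D)=s$.
   Context: All digraphs are finite, without loops and without multiple arcs; strongly connected means every ordered pair $(u,v)$ is joined by a directed $u$–$v$ path; a geodesic is a shortest directed path. An arc-coloured path is rainbow if its arcs have distinct colours; a vertex-coloured path is vertex-rainbow if its internal vertices have distinct colours; a total-coloured path is total-rainbow if its arcs and internal vertices all receive pairwise distinct colours. $\overrightarrow{rc}(D)$, $\overrightarrow{src}(D)$: minimum number of colours in an arc-colouring such that every ordered pair $(u,v)$ is joined by a rainbow path, resp. rainbow geodesic. $\overrightarrow{rvc}(D)$, $\overrightarrow{srvc}(D)$: minimum number of colours in a vertex-colouring such that every ordered pair is joined by a vertex-rainbow path, resp. geodesic. $\overrightarrow{trc}(D)$, $\overrightarrow{strc}(D)$: minimum number of colours in a total-colouring (of vertices and arcs) such that every ordered pair is joined by a total-rainbow path, resp. geodesic. -}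

module Defs where

open import Data.Nat using (ℕ; _≤_)
open import Data.Fin using (Fin)
open import Data.Bool using (Bool; T)
open import Data.List using (List; []; _∷_; _++_; map; length)
open import Data.List.Relation.Unary.Unique.Propositional using (Unique)
open import Data.Product using (Σ; _×_; _,_)
open import Relation.Nullary using (¬_)
open import Relation.Binary.PropositionalEquality using (_≢_)

record Digraph : Set where
  field
    n       : ℕ
    adj     : Fin n → Fin n → Bool
    loopless : ∀ v → ¬ T (adj v v)
open Digraph public

module _ (D : Digraph) where

  data Walk : Fin (n D) → Fin (n D) → Set where
    here : ∀ {u} → Walk u u
    step : ∀ {u w v} → T (adj D u w) → Walk w v → Walk u v

len : ∀ {D u v} → Walk D u v → ℕ
len here       = 0
len (step _ p) = Data.Nat.suc (len p)

vertices : ∀ {D u v} → Walk D u v → List (Fin (n D))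
vertices {v = v} here = v ∷ []
vertices {u = u} (step _ p) = u ∷ vertices p

verticesNoLast : ∀ {D u v} → Walk D u v → List (Fin (n D))
verticesNoLast here = []
verticesNoLast {u = u} (step _ p) = u ∷ verticesNoLast p

internal : ∀ {D u v} → Walk D u v → List (Fin (n D))
internal here = []
internal (step _ p) = verticesNoLast p

arcs : ∀ {D u v} → Walk D u v → List (Fin (n D) × Fin (n D))
arcs here = []
arcs {u = u} (step {w = w} _ p) = (u , w) ∷ arcs p

IsPath : ∀ {D u v} → Walk D u v → Set
IsPath p = Unique (vertices p)

IsGeodesic : ∀ {D u v} → Walk D u v → Set
IsGeodesic {D} {u} {v} p = IsPath p × (∀ (q : Walk D u v) → IsPath q → len p ≤ len q)

StronglyConnected : Digraph → Set
StronglyConnected D = ∀ (u v : Fin (n D)) → Σ (Walk D u v) IsPath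

-- colourings with k colours (colours = Fin k); arc colourings are
-- functions on ordered pairs, only their values on arcs matter
ArcColouring : Digraph → ℕ → Set
ArcColouring D k = Fin (n D) → Fin (n D) → Fin k

VertexColouring : Digraph → ℕ → Set
VertexColouring D k = Fin (n D) → Fin k

TotalColouring : Digraph → ℕ → Set
TotalColouring D k = ArcColouring D k × VertexColouring D k

arcColours : ∀ {D k u v} → ArcColouring D k → Walk D u v → List (Fin k)
arcColours c p = map (λ { (a , b) → c a b }) (arcs p)

Rainbow : ∀ {D k u v} → ArcColouring D k → Walk D u v → Set
Rainbow c p = Unique (arcColours c p)

VertexRainbow : ∀ {D k u v} → VertexColouring D k → Walk D u v → Set
VertexRainbow c p = Unique (map c (internal p))

TotalRainbow : ∀ {D k u v} → TotalColouring D k → Walk D u v → Set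
TotalRainbow (ca , cv) p = Unique (arcColours ca p ++ map cv (internal p))

Connects : (D : Digraph) → (∀ {u v} → Walk D u v → Set) → Set
Connects D Good = ∀ (u v : Fin (n D)) → u ≢ v → Σ (Walk D u v) (λ p → IsPath p × Good p)

GeoConnects : (D : Digraph) → (∀ {u v} → Walk D u v → Set) → Set
GeoConnects D Good = ∀ (u v : Fin (n D)) → u ≢ v → Σ (Walk D u v) (λ p → IsGeodesic p × Good p)

IsMinimum : (ℕ → Set) → ℕ → Set
IsMinimum P s = P s × (∀ k → P k → s ≤ k)

rc src rvc srvc trc strc : Digraph → ℕ → Set
rc   D = IsMinimum (λ k → Σ (ArcColouring D k)    λ c → Connects D (Rainbow c))
src  D = IsMinimum (λ k → Σ (ArcColouring D k)    λ c → GeoConnects D (Rainbow c))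
rvc  D = IsMinimum (λ k → Σ (VertexColouring D k) λ c → Connects D (VertexRainbow c))
srvc D = IsMinimum (λ k → Σ (VertexColouring D k) λ c → GeoConnects D (VertexRainbow c))
trc  D = IsMinimum (λ k → Σ (TotalColouring D k)  λ c → Connects D (TotalRainbow c))
strc D = IsMinimum (λ k → Σ (TotalColouring D k)  λ c → GeoConnects D (TotalRainbow c))

module Submission where

-- (a) A_N: a directed triangle a → b → c → a, a complete digraph on
--     x₀, …, x_{N+2} and 2-cycles a ↔ x₀, b ↔ x₁, c ↔ x₂.  A 3-colouring joins
--     all pairs by total-rainbow geodesics of length ≤ 2; the distance-2 pair
--     (a, c) needs three total colours, and going backwards round the triangle
--     forces distinct colours on its three arcs.  So trc = strc = rc = src = 3.
-- (b) B_S (S ≥ 13): a complete digraph on X₀, …, X_{S-1}, each X_i in a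
--     complete digraph with W₀_i, W₁_i.  X_i is the only exit and entrance of
--     {W₀_i, W₁_i}, so a vertex-rainbow path from W₀_i to W₀_j separates the
--     colours of X_i and X_j; an explicit colouring gives trc = rvc = S.
-- (c) C_S (S ≥ 13): a hub Z with X_i, U_i, V_i.  For "forced" pairs (i, j) the
--     only U_i–V_j geodesics run through X_i, X_j, and of any two indices one
--     ordered pair is forced, giving strc = srvc = S.

open import Defs
open import Data.Nat using (ℕ; _≤_)
open import Data.Fin using (Fin)
open import Data.Bool using (Bool; T)
open import Data.Product using (Σ; _×_; _,_)
open import Function.Bundles using (_↔_)
open import Relation.Nullary using (¬_)

module ListFacts where

  open import Data.Nat using (_≤_)
  open import Data.Fin using (Fin; zero; suc)
  open import Data.Fin.Properties using (injective⇒≤)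
  open import Data.List using (List; []; _∷_; _++_; map)
  open import Data.List.Membership.Propositional using (_∈_)
  open import Data.List.Relation.Unary.Any using (here; there)
  open import Data.List.Relation.Unary.All using (_∷_)
  import Data.List.Relation.Unary.All as All
  import Data.List.Relation.Unary.All.Properties as All
  open import Data.List.Relation.Unary.Unique.Propositional using (Unique; []; _∷_)
  open import Data.Empty using (⊥-elim)
  open import Function.Definitions using (Injective)
  open import Relation.Binary.PropositionalEquality using (_≡_; _≢_; refl; sym)

  distinct3⇒3≤ : ∀ {k} {x y z : Fin k} → x ≢ y → x ≢ z → y ≢ z → 3 ≤ k
  distinct3⇒3≤ {k} {x} {y} {z} x≢y x≢z y≢z = injective⇒≤ {f = pick} pick-injective
    where
    pick : Fin 3 → Fin k
    pick zero = x
    pick (suc zero) = y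
    pick (suc (suc zero)) = z

    pick-injective : Injective _≡_ _≡_ pick
    pick-injective {zero} {zero} _ = refl
    pick-injective {zero} {suc zero} e = ⊥-elim (x≢y e)
    pick-injective {zero} {suc (suc zero)} e = ⊥-elim (x≢z e)
    pick-injective {suc zero} {zero} e = ⊥-elim (x≢y (sym e))
    pick-injective {suc zero} {suc zero} _ = refl
    pick-injective {suc zero} {suc (suc zero)} e = ⊥-elim (y≢z e)
    pick-injective {suc (suc zero)} {zero} e = ⊥-elim (x≢z (sym e))
    pick-injective {suc (suc zero)} {suc zero} e = ⊥-elim (y≢z (sym e))
    pick-injective {suc (suc zero)} {suc (suc zero)} _ = refl

  three-colours : ∀ {k} {x y z : Fin k} {zs : List (Fin k)} →
                  Unique (x ∷ y ∷ zs) → z ∈ zs → 3 ≤ k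
  three-colours ((x≢y ∷ x∉zs) ∷ y∉zs ∷ _) z∈zs =
    distinct3⇒3≤ x≢y (All.lookup x∉zs z∈zs) (All.lookup y∉zs z∈zs)

  unique-++ˡ : ∀ {A : Set} (xs : List A) {ys : List A} → Unique (xs ++ ys) → Unique xs
  unique-++ˡ [] _ = []
  unique-++ˡ (x ∷ xs) (x∉ ∷ u) = All.++⁻ˡ xs x∉ ∷ unique-++ˡ xs u

  unique-++ʳ : ∀ {A : Set} (xs : List A) {ys : List A} → Unique (xs ++ ys) → Unique ys
  unique-++ʳ [] u = u
  unique-++ʳ (x ∷ xs) (_ ∷ u) = unique-++ʳ xs u

  unique-map-≢ : ∀ {A B : Set} (f : A → B) {xs : List A} {a b : A} →
                 Unique (map f xs) → a ∈ xs → b ∈ xs → a ≢ b → f a ≢ f b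
  unique-map-≢ f (_ ∷ _) (here refl) (here refl) a≢b = λ _ → a≢b refl
  unique-map-≢ f (fx∉ ∷ _) (here refl) (there b∈) _ = All.lookup (All.map⁻ fx∉) b∈
  unique-map-≢ f (fx∉ ∷ _) (there a∈) (here refl) _ = λ e → All.lookup (All.map⁻ fx∉) a∈ (sym e)
  unique-map-≢ f (_ ∷ u) (there a∈) (there b∈) a≢b = unique-map-≢ f u a∈ b∈ a≢b

module WalkFacts where

  open import Defs
  open ListFacts
  open import Data.Nat using (_≤_; z≤n; s≤s)
  open import Data.Fin using (Fin)
  open import Data.Bool using (Bool; T)
  open import Data.Empty using (⊥-elim)
  open import Data.List.Membership.Propositional using (_∈_)
  open import Data.List.Relation.Unary.Any using (here; there)
  open import Data.List.Relation.Unary.All using ([]; _∷_)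
  open import Data.List.Relation.Unary.Unique.Propositional using ([]; _∷_)
  open import Data.Product using (_,_)
  open import Data.Sum using (_⊎_; inj₁; inj₂)
  open import Relation.Nullary using (¬_; yes; no)
  open import Relation.Nullary.Decidable using (T?)
  open import Relation.Binary.PropositionalEquality using (_≡_; _≢_; refl)

  module _ {D : Digraph} where

    len≥1 : ∀ {u v} → u ≢ v → (q : Walk D u v) → 1 ≤ len q
    len≥1 u≢v here = ⊥-elim (u≢v refl)
    len≥1 u≢v (step _ _) = s≤s z≤n

    len≥2 : ∀ {u v} → u ≢ v → ¬ T (adj D u v) → (q : Walk D u v) → 2 ≤ len q
    len≥2 u≢v _ here = ⊥-elim (u≢v refl)
    len≥2 u≢v ¬uv (step uv here) = ⊥-elim (¬uv uv)
    len≥2 u≢v _ (step _ (step _ _)) = s≤s (s≤s z≤n)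

    arc-geodesic : ∀ {u v} → u ≢ v → (uv : T (adj D u v)) → IsGeodesic (step uv here)
    arc-geodesic u≢v _ = ((u≢v ∷ []) ∷ [] ∷ []) , λ q _ → len≥1 u≢v q

    twoArc-geodesic : ∀ {u w v} → u ≢ w → u ≢ v → w ≢ v →
                      (uw : T (adj D u w)) (wv : T (adj D w v)) → ¬ T (adj D u v) →
                      IsGeodesic (step uw (step wv here))
    twoArc-geodesic u≢w u≢v w≢v _ _ ¬uv =
      ((u≢w ∷ u≢v ∷ []) ∷ (w≢v ∷ []) ∷ [] ∷ []) , λ q _ → len≥2 u≢v ¬uv q

    ∈verticesNoLast : ∀ {x y} (p : Walk D x y) {a} → a ∈ vertices p → a ≢ y → a ∈ verticesNoLast p
    ∈verticesNoLast here (here refl) a≢y = ⊥-elim (a≢y refl)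
    ∈verticesNoLast (step _ p) (here refl) _ = here refl
    ∈verticesNoLast (step _ p) (there a∈) a≢y = there (∈verticesNoLast p a∈ a≢y)

    ∈internal : ∀ {x y} (p : Walk D x y) {a} → a ∈ vertices p → a ≢ x → a ≢ y → a ∈ internal p
    ∈internal here (here refl) a≢x _ = ⊥-elim (a≢x refl)
    ∈internal (step _ p) (here refl) a≢x _ = ⊥-elim (a≢x refl)
    ∈internal (step _ p) (there a∈) _ a≢y = ∈verticesNoLast p a∈ a≢y

    private
      start∈ : ∀ {w y} (q : Walk D w y) → w ∈ vertices q
      start∈ here = here refl
      start∈ (step _ _) = here refl

    leaves-through : (R : Fin (n D) → Bool) (e : Fin (n D)) →
                     (∀ a b → T (adj D a b) → T (R a) → T (R b) ⊎ b ≡ e) →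
                     ∀ {x y} (p : Walk D x y) → T (R x) → ¬ T (R y) → e ∈ vertices p
    leaves-through R e gate here Rx ¬Ry = ⊥-elim (¬Ry Rx)
    leaves-through R e gate {x} (step {w = w} xw q) Rx ¬Ry with gate x w xw Rx
    ... | inj₁ Rw = there (leaves-through R e gate q Rw ¬Ry)
    ... | inj₂ refl = there (start∈ q)

    enters-through : (R : Fin (n D) → Bool) (e : Fin (n D)) →
                     (∀ a b → T (adj D a b) → T (R b) → T (R a) ⊎ a ≡ e) →
                     ∀ {x y} (p : Walk D x y) → ¬ T (R x) → T (R y) → e ∈ vertices p
    enters-through R e gate here ¬Rx Ry = ⊥-elim (¬Rx Ry)
    enters-through R e gate {x} (step {w = w} xw q) ¬Rx Ry with T? (R w)
    ... | no ¬Rw = there (enters-through R e gate q ¬Rw Ry)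
    ... | yes Rw with gate x w xw Rw
    ...   | inj₁ Rx = ⊥-elim (¬Rx Rx)
    ...   | inj₂ refl = here refl

module Parameters where

  open import Defs
  open ListFacts
  open WalkFacts
  open import Data.Nat using (_≤_)
  open import Data.Fin using (Fin)
  open import Data.Fin.Properties using (_≟_)
  open import Data.Bool using (T)
  open import Data.List.Membership.Propositional.Properties using (∈-++⁺ʳ)
  open import Data.List.Relation.Unary.Any using (here)
  open import Data.List.Relation.Unary.All using ([]; _∷_)
  open import Data.List.Relation.Unary.Unique.Propositional using ([]; _∷_)
  open import Data.Empty using (⊥-elim)
  open import Data.Product using (Σ; _×_; _,_; proj₁)
  open import Data.Sum using (_⊎_; inj₁; inj₂)
  open import Relation.Nullary using (¬_; yes; no)
  open import Relation.Binary.PropositionalEquality using (_≡_; _≢_; refl)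

  module _ {D : Digraph} where

    connects-map : {P Q : ∀ {u v} → Walk D u v → Set} →
                   (∀ {u v} (p : Walk D u v) → P p → Q p) → Connects D P → Connects D Q
    connects-map P⇒Q C u v u≢v with C u v u≢v
    ... | p , isPath , good = p , isPath , P⇒Q p good

    geoConnects-map : {P Q : ∀ {u v} → Walk D u v → Set} →
                      (∀ {u v} (p : Walk D u v) → P p → Q p) → GeoConnects D P → GeoConnects D Q
    geoConnects-map P⇒Q C u v u≢v with C u v u≢v
    ... | p , isGeodesic , good = p , isGeodesic , P⇒Q p good

    geoConnects⇒connects : {P : ∀ {u v} → Walk D u v → Set} → GeoConnects D P → Connects D P
    geoConnects⇒connects C u v u≢v with C u v u≢v
    ... | p , isGeodesic , good = p , proj₁ isGeodesic , good

    connects⇒stronglyConnected : {P : ∀ {u v} → Walk D u v → Set} →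
                                 Connects D P → StronglyConnected D
    connects⇒stronglyConnected C u v with u ≟ v
    ... | yes refl = here , [] ∷ []
    ... | no u≢v with C u v u≢v
    ...   | p , isPath , _ = p , isPath

    totalRainbow⇒rainbow : ∀ {k} (ca : ArcColouring D k) (cv : VertexColouring D k) {u v}
                           (p : Walk D u v) → TotalRainbow (ca , cv) p → Rainbow ca p
    totalRainbow⇒rainbow ca cv p = unique-++ˡ (arcColours ca p)

    totalRainbow⇒vertexRainbow : ∀ {k} (ca : ArcColouring D k) (cv : VertexColouring D k) {u v}
                                 (p : Walk D u v) → TotalRainbow (ca , cv) p → VertexRainbow cv p
    totalRainbow⇒vertexRainbow ca cv p = unique-++ʳ (arcColours ca p)

    -- A total-rainbow walk between distinct non-adjacent vertices shows two
    -- arc colours and an internal vertex colour, all distinct.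
    totalRainbow⇒3≤ : ∀ {k u v} {ca : ArcColouring D k} {cv : VertexColouring D k} →
                      u ≢ v → ¬ T (adj D u v) →
                      (p : Walk D u v) → TotalRainbow (ca , cv) p → 3 ≤ k
    totalRainbow⇒3≤ u≢v ¬uv here _ = ⊥-elim (u≢v refl)
    totalRainbow⇒3≤ u≢v ¬uv (step uv here) _ = ⊥-elim (¬uv uv)
    totalRainbow⇒3≤ {ca = ca} u≢v ¬uv (step _ (step _ q)) rainbow =
      three-colours rainbow (∈-++⁺ʳ (arcColours ca q) (here refl))

    rainbowDetour : ∀ {k u v} (c : ArcColouring D k) → u ≢ v → ¬ T (adj D u v) →
                    (p : Walk D u v) → Rainbow c p →
                    3 ≤ k ⊎ Σ (Fin (n D)) λ w → T (adj D u w) × T (adj D w v) × c u w ≢ c w v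
    rainbowDetour c u≢v ¬uv here _ = ⊥-elim (u≢v refl)
    rainbowDetour c u≢v ¬uv (step uv here) _ = ⊥-elim (¬uv uv)
    rainbowDetour c u≢v ¬uv (step uw (step wv here)) ((c₁≢c₂ ∷ _) ∷ _) = inj₂ (_ , uw , wv , c₁≢c₂)
    rainbowDetour c u≢v ¬uv (step _ (step _ (step _ _))) rainbow = inj₁ (three-colours rainbow (here refl))

    rainbowThrough : ∀ {k u v} (c : ArcColouring D k) → Connects D (Rainbow c) →
                     (w : Fin (n D)) → u ≢ v → ¬ T (adj D u v) →
                     (∀ w′ → T (adj D u w′) → T (adj D w′ v) → w′ ≡ w) →
                     3 ≤ k ⊎ c u w ≢ c w v
    rainbowThrough c C w u≢v ¬uv only with C _ _ u≢v
    ... | p , _ , rainbow with rainbowDetour c u≢v ¬uv p rainbow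
    ...   | inj₁ 3≤k = inj₁ 3≤k
    ...   | inj₂ (w′ , uw′ , w′v , c≢) with only w′ uw′ w′v
    ...     | refl = inj₂ c≢

module Evaluation where

  open import Data.Nat using (ℕ; _+_)
  open import Data.Fin using (Fin; _↑ˡ_; _↑ʳ_; splitAt)
  open import Data.Fin.Properties using (_≟_; splitAt⁻¹-↑ˡ; splitAt⁻¹-↑ʳ)
  open import Data.Bool using (Bool; true; false; T; not; _∧_)
  open import Data.Bool.Properties using (T-∧)
  open import Data.Unit using (tt)
  open import Data.List using (List)
  open import Data.List.Relation.Unary.Unique.Propositional using (Unique)
  open import Data.List.Relation.Unary.Unique.DecPropositional using (unique?)
  open import Data.Product using (_×_; _,_)
  open import Data.Sum using (inj₁; inj₂)
  open import Function.Bundles using (Equivalence)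
  open import Relation.Nullary using (¬_; Dec; yes)
  open import Relation.Nullary.Decidable
    using (⌊_⌋; True; map′; toWitness; fromWitness; toWitnessFalse; fromWitnessFalse)
  open import Relation.Binary.PropositionalEquality using (_≡_; _≢_; refl; subst)

  not⇒¬ : ∀ {b} → T (not b) → ¬ T b
  not⇒¬ {false} _ ()

  ¬⇒not : ∀ {b} → ¬ T b → T (not b)
  ¬⇒not {false} _ = tt
  ¬⇒not {true} ¬b = ¬b tt

  ∧-elim : ∀ {x y} → T (x ∧ y) → T x × T y
  ∧-elim = Equivalence.to T-∧

  ∧-intro : ∀ {x y} → T x → T y → T (x ∧ y)
  ∧-intro Tx Ty = Equivalence.from T-∧ (Tx , Ty)

  -- Boolean equality of Fin, for definitions that have to compute.
  infix 4 _==_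
  _==_ : ∀ {n} → Fin n → Fin n → Bool
  i == j = ⌊ i ≟ j ⌋

  ==-refl : ∀ {n} (i : Fin n) → T (i == i)
  ==-refl i = fromWitness refl

  ==-sound : ∀ {n} {i j : Fin n} → T (i == j) → i ≡ j
  ==-sound = toWitness

  ≢⇒/= : ∀ {n} {i j : Fin n} → i ≢ j → T (not (i == j))
  ≢⇒/= = fromWitnessFalse

  /=⇒≢ : ∀ {n} {i j : Fin n} → T (not (i == j)) → i ≢ j
  /=⇒≢ = toWitnessFalse

  -- Fin (a + m) as the elements of Fin a ("low", which compute to numerals)
  -- followed by those of Fin m ("high").
  data Split (a m : ℕ) : Fin (a + m) → Set where
    low  : (k : Fin a) → Split a m (k ↑ˡ m)
    high : (j : Fin m) → Split a m (a ↑ʳ j)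

  split : ∀ {a m} (i : Fin (a + m)) → Split a m i
  split {a} {m} i with splitAt a i in eq
  ... | inj₁ k = subst (Split a m) (splitAt⁻¹-↑ˡ eq) (low k)
  ... | inj₂ j = subst (Split a m) (splitAt⁻¹-↑ʳ eq) (high j)

  distinct : ∀ {n} {xs : List (Fin n)} {ok : True (unique? _≟_ xs)} → Unique xs
  distinct {ok = ok} = toWitness ok

  ∀T? : (b : Bool) {P : T b → Set} → ((h : T b) → Dec (P h)) → Dec ((h : T b) → P h)
  ∀T? false P? = yes λ ()
  ∀T? true P? = map′ (λ p _ → p) (λ f → f tt) (P? tt)

-- Walks, colourings, paths and geodesics are
-- built and checked on V, where they compute, and then lowered to Fin N.
module Relabel (V : Set) (N : ℕ) (code : Fin N ↔ V)
               (adjV : V → V → Bool) (looplessV : ∀ v → ¬ T (adjV v v)) where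

  open import Defs
  open WalkFacts
  open import Function.Bundles using (Inverse)
  open import Data.Nat using (suc; _≤_)
  open import Data.List using (List; []; _∷_; _++_; map)
  open import Data.List.Membership.Propositional using (_∈_)
  open import Data.List.Relation.Unary.Unique.Propositional using (Unique)
  import Data.List.Relation.Unary.Unique.Propositional.Properties as Unique
  open import Data.Product using (Σ; _×_; _,_)
  open import Data.Sum using (_⊎_; inj₁; inj₂)
  open import Relation.Binary.PropositionalEquality
    using (_≡_; _≢_; refl; sym; trans; cong; cong₂; subst; subst₂; module ≡-Reasoning)

  dec : Fin N → V
  dec = Inverse.to code

  enc : V → Fin N
  enc = Inverse.from code

  dec-enc : ∀ v → dec (enc v) ≡ v
  dec-enc = Inverse.strictlyInverseˡ code

  enc-dec : ∀ x → enc (dec x) ≡ x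
  enc-dec = Inverse.strictlyInverseʳ code

  dec-injective : ∀ {x y} → dec x ≡ dec y → x ≡ y
  dec-injective {x} {y} e = trans (sym (enc-dec x)) (trans (cong enc e) (enc-dec y))

  enc-injective : ∀ {u v} → enc u ≡ enc v → u ≡ v
  enc-injective {u} {v} e = trans (sym (dec-enc u)) (trans (cong dec e) (dec-enc v))

  enc-≢ : ∀ {u v} → u ≢ v → enc u ≢ enc v
  enc-≢ u≢v e = u≢v (enc-injective e)

  D : Digraph
  D = record { n = N ; adj = λ a b → adjV (dec a) (dec b) ; loopless = λ a → looplessV (dec a) }

  adj-enc : ∀ {u w} → T (adjV u w) → T (adj D (enc u) (enc w))
  adj-enc {u} {w} = subst₂ (λ a b → T (adjV a b)) (sym (dec-enc u)) (sym (dec-enc w))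

  ¬adj-enc : ∀ {u w} → ¬ T (adjV u w) → ¬ T (adj D (enc u) (enc w))
  ¬adj-enc {u} {w} ¬uw = λ h → ¬uw (subst₂ (λ a b → T (adjV a b)) (dec-enc u) (dec-enc w) h)

  data Route : V → V → Set where
    end  : ∀ {u} → Route u u
    step : ∀ {u v} w → T (adjV u w) → Route w v → Route u v

  _++ʳ_ : ∀ {u w v} → Route u w → Route w v → Route u v
  end ++ʳ q = q
  step w h p ++ʳ q = step w h (p ++ʳ q)

  routeVertices : ∀ {u v} → Route u v → List V
  routeVertices {v = v} end = v ∷ []
  routeVertices {u = u} (step _ _ p) = u ∷ routeVertices p

  routeNoLast : ∀ {u v} → Route u v → List V
  routeNoLast end = []
  routeNoLast {u = u} (step _ _ p) = u ∷ routeNoLast p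

  routeInternal : ∀ {u v} → Route u v → List V
  routeInternal end = []
  routeInternal (step _ _ p) = routeNoLast p

  routeLength : ∀ {u v} → Route u v → ℕ
  routeLength end = 0
  routeLength (step _ _ p) = suc (routeLength p)

  lower : ∀ {u v} → Route u v → Walk D (enc u) (enc v)
  lower end = here
  lower (step _ h p) = step (adj-enc h) (lower p)

  lower-vertices : ∀ {u v} (p : Route u v) → vertices (lower p) ≡ map enc (routeVertices p)
  lower-vertices end = refl
  lower-vertices (step _ _ p) = cong (_ ∷_) (lower-vertices p)

  lower-noLast : ∀ {u v} (p : Route u v) → verticesNoLast (lower p) ≡ map enc (routeNoLast p)
  lower-noLast end = refl
  lower-noLast (step _ _ p) = cong (_ ∷_) (lower-noLast p)

  lower-internal : ∀ {u v} (p : Route u v) → internal (lower p) ≡ map enc (routeInternal p)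
  lower-internal end = refl
  lower-internal (step _ _ p) = lower-noLast p

  lower-length : ∀ {u v} (p : Route u v) → len (lower p) ≡ routeLength p
  lower-length end = refl
  lower-length (step _ _ p) = cong suc (lower-length p)

  lower-isPath : ∀ {u v} (p : Route u v) → Unique (routeVertices p) → IsPath (lower p)
  lower-isPath p u = subst Unique (sym (lower-vertices p)) (Unique.map⁺ enc-injective u)

  raise : ∀ {x y} → Walk D x y → Route (dec x) (dec y)
  raise here = end
  raise (step {w = w} h p) = step (dec w) h (raise p)

  raise-length : ∀ {x y} (p : Walk D x y) → routeLength (raise p) ≡ len p
  raise-length here = refl
  raise-length (step _ p) = cong suc (raise-length p)

  raise-noLast : ∀ {x y} (p : Walk D x y) → routeNoLast (raise p) ≡ map dec (verticesNoLast p)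
  raise-noLast here = refl
  raise-noLast (step _ p) = cong (_ ∷_) (raise-noLast p)

  raise-internal : ∀ {x y} (p : Walk D x y) → routeInternal (raise p) ≡ map dec (internal p)
  raise-internal here = refl
  raise-internal (step _ p) = raise-noLast p

  raiseAt : ∀ {u v} (q : Walk D (enc u) (enc v)) →
            Σ (Route u v) λ r → routeLength r ≡ len q × routeInternal r ≡ map dec (internal q)
  raiseAt {u} {v} q = transport (dec-enc u) (dec-enc v) (raise q) (raise-length q) (raise-internal q)
    where
    transport : ∀ {u′ v′} → u′ ≡ u → v′ ≡ v → (r : Route u′ v′) →
                routeLength r ≡ len q → routeInternal r ≡ map dec (internal q) →
                Σ (Route u v) λ r → routeLength r ≡ len q × routeInternal r ≡ map dec (internal q)
    transport refl refl r length≡ internal≡ = r , length≡ , internal≡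

  lower-geodesic : ∀ {u v} (p : Route u v) → Unique (routeVertices p) →
                   (∀ (q : Route u v) → routeLength p ≤ routeLength q) → IsGeodesic (lower p)
  lower-geodesic p unique shortest = lower-isPath p unique , λ q _ →
    let (r , r≡q , _) = raiseAt q in subst₂ _≤_ (sym (lower-length p)) r≡q (shortest r)

  arc-geodesicᵛ : ∀ {u v} → u ≢ v → (h : T (adjV u v)) → IsGeodesic (lower (step v h end))
  arc-geodesicᵛ u≢v h = arc-geodesic (enc-≢ u≢v) (adj-enc h)

  twoArc-geodesicᵛ : ∀ {u v} w → u ≢ w → u ≢ v → w ≢ v →
                     (uw : T (adjV u w)) (wv : T (adjV w v)) → ¬ T (adjV u v) →
                     IsGeodesic (lower (step w uw (step v wv end)))
  twoArc-geodesicᵛ w u≢w u≢v w≢v uw wv ¬uv =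
    twoArc-geodesic (enc-≢ u≢w) (enc-≢ u≢v) (enc-≢ w≢v) (adj-enc uw) (adj-enc wv) (¬adj-enc ¬uv)

  connectsᵛ : (P : ∀ {x y} → Walk D x y → Set) →
              (∀ u v → u ≢ v → Σ (Route u v) (λ p → P (lower p))) →
              ∀ (x y : Fin N) → x ≢ y → Σ (Walk D x y) P
  connectsᵛ P C x y x≢y with C (dec x) (dec y) (λ e → x≢y (dec-injective e))
  ... | p , Pp = subst₂ (λ a b → Σ (Walk D a b) P) (enc-dec x) (enc-dec y) (lower p , Pp)

  leaves-throughᵛ : (R : V → Bool) (e : V) → (∀ a b → T (adjV a b) → T (R a) → T (R b) ⊎ b ≡ e) →
                    ∀ {x y} (p : Walk D x y) → T (R (dec x)) → ¬ T (R (dec y)) → enc e ∈ vertices p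
  leaves-throughᵛ R e gate = leaves-through (λ x → R (dec x)) (enc e) gate′
    where
    gate′ : ∀ a b → T (adj D a b) → T (R (dec a)) → T (R (dec b)) ⊎ b ≡ enc e
    gate′ a b h Ra with gate (dec a) (dec b) h Ra
    ... | inj₁ Rb = inj₁ Rb
    ... | inj₂ b≡e = inj₂ (trans (sym (enc-dec b)) (cong enc b≡e))

  enters-throughᵛ : (R : V → Bool) (e : V) → (∀ a b → T (adjV a b) → T (R b) → T (R a) ⊎ a ≡ e) →
                    ∀ {x y} (p : Walk D x y) → ¬ T (R (dec x)) → T (R (dec y)) → enc e ∈ vertices p
  enters-throughᵛ R e gate = enters-through (λ x → R (dec x)) (enc e) gate′
    where
    gate′ : ∀ a b → T (adj D a b) → T (R (dec b)) → T (R (dec a)) ⊎ a ≡ enc e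
    gate′ a b h Rb with gate (dec a) (dec b) h Rb
    ... | inj₁ Ra = inj₁ Ra
    ... | inj₂ a≡e = inj₂ (trans (sym (enc-dec a)) (cong enc a≡e))

  module Colouring {k : ℕ} (arcColourᵛ : V → V → Fin k) (vertexColourᵛ : V → Fin k) where

    arcColour : ArcColouring D k
    arcColour a b = arcColourᵛ (dec a) (dec b)

    vertexColour : VertexColouring D k
    vertexColour a = vertexColourᵛ (dec a)

    colouring : TotalColouring D k
    colouring = arcColour , vertexColour

    routeArcColours : ∀ {u v} → Route u v → List (Fin k)
    routeArcColours end = []
    routeArcColours {u = u} (step w _ p) = arcColourᵛ u w ∷ routeArcColours p

    routeColours : ∀ {u v} → Route u v → List (Fin k)
    routeColours p = routeArcColours p ++ map vertexColourᵛ (routeInternal p)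

    lower-arcColours : ∀ {u v} (p : Route u v) → arcColours arcColour (lower p) ≡ routeArcColours p
    lower-arcColours end = refl
    lower-arcColours {u = u} (step w _ p) =
      cong₂ _∷_ (cong₂ arcColourᵛ (dec-enc u) (dec-enc w)) (lower-arcColours p)

    lower-vertexColours : ∀ xs → map vertexColour (map enc xs) ≡ map vertexColourᵛ xs
    lower-vertexColours [] = refl
    lower-vertexColours (x ∷ xs) = cong₂ _∷_ (cong vertexColourᵛ (dec-enc x)) (lower-vertexColours xs)

    lower-internalColours : ∀ {u v} (p : Route u v) →
                            map vertexColour (internal (lower p)) ≡ map vertexColourᵛ (routeInternal p)
    lower-internalColours p = begin
      map vertexColour (internal (lower p))         ≡⟨ cong (map vertexColour) (lower-internal p) ⟩
      map vertexColour (map enc (routeInternal p))  ≡⟨ lower-vertexColours (routeInternal p) ⟩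
      map vertexColourᵛ (routeInternal p)           ∎
      where open ≡-Reasoning

    lower-totalRainbow : ∀ {u v} (p : Route u v) → Unique (routeColours p) →
                         TotalRainbow colouring (lower p)
    lower-totalRainbow p =
      subst Unique (sym (cong₂ _++_ (lower-arcColours p) (lower-internalColours p)))

module PartA where

  open import Defs
  open ListFacts
  open WalkFacts
  open Parameters
  open Evaluation
  open import Data.Nat using (ℕ; _+_; _≤_)
  open import Data.Nat.Properties using (m≤n+m)
  open import Data.Fin using (Fin; zero; suc; #_)
  open import Data.Bool using (Bool; true; false; T; not)
  open import Data.Empty using (⊥-elim)
  open import Data.List.Relation.Unary.All using ([]; _∷_)
  open import Data.List.Relation.Unary.Unique.Propositional using ([]; _∷_)
  open import Data.Product using (Σ; _×_; _,_)
  open import Data.Sum using (inj₁; inj₂)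
  open import Relation.Nullary using (¬_)
  open import Relation.Binary.PropositionalEquality using (_≡_; _≢_; refl; sym; cong)

  module _ (N : ℕ) where

    Vertex : Set
    Vertex = Fin (6 + N)

    pattern a = zero
    pattern b = suc zero
    pattern c = suc (suc zero)
    pattern x i = suc (suc (suc i))

    adjA : Vertex → Vertex → Bool
    adjA (x i) (x j) = not (i == j)
    adjA a b = true
    adjA b c = true
    adjA c a = true
    adjA a (x zero) = true
    adjA (x zero) a = true
    adjA b (x (suc zero)) = true
    adjA (x (suc zero)) b = true
    adjA c (x (suc (suc zero))) = true
    adjA (x (suc (suc zero))) c = true
    adjA _ _ = false

    looplessA : ∀ v → ¬ T (adjA v v)
    looplessA a ()
    looplessA b ()
    looplessA c ()
    looplessA (x i) i≠i = /=⇒≢ i≠i refl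

    A : Digraph
    A = record { n = 6 + N ; adj = adjA ; loopless = looplessA }

    arcColourA : ArcColouring A 3
    arcColourA (x _) (x _) = # 2
    arcColourA a b = # 0
    arcColourA b c = # 1
    arcColourA c a = # 2
    arcColourA _ _ = # 1

    vertexColourA : VertexColouring A 3
    vertexColourA a = # 1
    vertexColourA b = # 2
    vertexColourA c = # 0
    vertexColourA (x _) = # 0

    colouringA : TotalColouring A 3
    colouringA = arcColourA , vertexColourA

    Joined : Vertex → Vertex → Set
    Joined u v = Σ (Walk A u v) λ p → IsGeodesic p × TotalRainbow colouringA p

    -- A two-arc walk u → w → v joins them when
    -- u, v are not adjacent and its three colours differ; these side
    -- conditions are implicit Boolean facts, which for concrete vertices
    -- evaluate to true and are filled in automatically.
    arc : ∀ {u v} {uv : T (adjA u v)} → u ≢ v → Joined u v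
    arc {uv = uv} u≢v = step uv here , arc-geodesic u≢v uv , [] ∷ []

    via : ∀ {u v} w {uw : T (adjA u w)} {wv : T (adjA w v)} {¬uv : T (not (adjA u v))}
          {u≠w : T (not (u == w))} {u≠v : T (not (u == v))} {w≠v : T (not (w == v))}
          {c₁≠c₂ : T (not (arcColourA u w == arcColourA w v))}
          {c₁≠cw : T (not (arcColourA u w == vertexColourA w))}
          {c₂≠cw : T (not (arcColourA w v == vertexColourA w))} → Joined u v
    via w {uw} {wv} {¬uv} {u≠w} {u≠v} {w≠v} {c₁≠c₂} {c₁≠cw} {c₂≠cw} =
      step uw (step wv here) ,
      twoArc-geodesic (/=⇒≢ u≠w) (/=⇒≢ u≠v) (/=⇒≢ w≠v) uw wv (not⇒¬ ¬uv) ,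
      ((/=⇒≢ c₁≠c₂ ∷ /=⇒≢ c₁≠cw ∷ []) ∷ (/=⇒≢ c₂≠cw ∷ []) ∷ [] ∷ [])

    joined : GeoConnects A (TotalRainbow colouringA)
    joined a a a≢a = ⊥-elim (a≢a refl)
    joined a b ne = arc ne
    joined a c _ = via b
    joined a (x zero) ne = arc ne
    joined a (x (suc _)) _ = via (x zero)
    joined b a _ = via c
    joined b b b≢b = ⊥-elim (b≢b refl)
    joined b c ne = arc ne
    joined b (x zero) _ = via (x (suc zero))
    joined b (x (suc zero)) ne = arc ne
    joined b (x (suc (suc _))) _ = via (x (suc zero))
    joined c a ne = arc ne
    joined c b _ = via a
    joined c c c≢c = ⊥-elim (c≢c refl)
    joined c (x zero) _ = via (x (suc (suc zero)))
    joined c (x (suc zero)) _ = via (x (suc (suc zero)))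
    joined c (x (suc (suc zero))) ne = arc ne
    joined c (x (suc (suc (suc _)))) _ = via (x (suc (suc zero)))
    joined (x zero) a ne = arc ne
    joined (x (suc _)) a _ = via (x zero)
    joined (x zero) b _ = via (x (suc zero))
    joined (x (suc zero)) b ne = arc ne
    joined (x (suc (suc _))) b _ = via (x (suc zero))
    joined (x zero) c _ = via (x (suc (suc zero)))
    joined (x (suc zero)) c _ = via (x (suc (suc zero)))
    joined (x (suc (suc zero))) c ne = arc ne
    joined (x (suc (suc (suc _)))) c _ = via (x (suc (suc zero)))
    joined (x i) (x j) ne = arc {uv = ≢⇒/= λ i≡j → ne (cong (λ k → x k) i≡j)} ne

    -- Lower bound for total colourings: a and c are at distance 2.
    totalLowerBound : ∀ {k} (ca : ArcColouring A k) (cv : VertexColouring A k) →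
                      Connects A (TotalRainbow (ca , cv)) → 3 ≤ k
    totalLowerBound ca cv C with C a c (λ ())
    ... | p , _ , rainbow = totalRainbow⇒3≤ (λ ()) (λ ()) p rainbow

    middle-ac : ∀ w → T (adjA a w) → T (adjA w c) → w ≡ b
    middle-ac b _ _ = refl
    middle-ac (x zero) _ ()

    middle-ba : ∀ w → T (adjA b w) → T (adjA w a) → w ≡ c
    middle-ba c _ _ = refl
    middle-ba (x (suc zero)) _ ()

    middle-cb : ∀ w → T (adjA c w) → T (adjA w b) → w ≡ a
    middle-cb a _ _ = refl
    middle-cb (x (suc (suc zero))) _ ()

    -- Lower bound for arc colourings: the three arcs of the triangle receive
    -- distinct colours unless three colours are forced anyway.
    arcLowerBound : ∀ {k} (col : ArcColouring A k) → Connects A (Rainbow col) → 3 ≤ k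
    arcLowerBound col C
      with rainbowThrough col C b (λ ()) (λ ()) middle-ac
         | rainbowThrough col C c (λ ()) (λ ()) middle-ba
         | rainbowThrough col C a (λ ()) (λ ()) middle-cb
    ... | inj₁ 3≤k | _ | _ = 3≤k
    ... | inj₂ _ | inj₁ 3≤k | _ = 3≤k
    ... | inj₂ _ | inj₂ _ | inj₁ 3≤k = 3≤k
    ... | inj₂ ab≢bc | inj₂ bc≢ca | inj₂ ca≢ab = distinct3⇒3≤ ab≢bc (λ e → ca≢ab (sym e)) bc≢ca

  partA : (N : ℕ) → Σ Digraph λ D →
          N ≤ n D × StronglyConnected D × trc D 3 × strc D 3 × rc D 3 × src D 3
  partA N = A N , m≤n+m N 6 , connects⇒stronglyConnected paths
          , ((colouringA N , paths) , λ { k ((ca , cv) , C) → totalLowerBound N ca cv C })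
          , ((colouringA N , joined N) , λ { k ((ca , cv) , C) →
              totalLowerBound N ca cv (geoConnects⇒connects C) })
          , ((arcColourA N , connects-map arcPart paths) , λ { k (col , C) → arcLowerBound N col C })
          , ((arcColourA N , geoConnects-map arcPart (joined N)) , λ { k (col , C) →
              arcLowerBound N col (geoConnects⇒connects C) })
    where
    paths : Connects (A N) (TotalRainbow (colouringA N))
    paths = geoConnects⇒connects (joined N)

    arcPart : ∀ {u v} (p : Walk (A N) u v) → TotalRainbow (colouringA N) p → Rainbow (arcColourA N) p
    arcPart = totalRainbow⇒rainbow (arcColourA N) (vertexColourA N)

module PartB where

  open import Defs
  open ListFacts
  open WalkFacts
  open Parameters
  open Evaluation
  open import Data.Nat using (ℕ; _+_; _*_; _∸_; _≤_; _<ᵇ_)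
  open import Data.Nat.Properties using (m+[n∸m]≡n)
  open import Data.Fin using (Fin; zero; suc; toℕ; _↑ˡ_; _↑ʳ_; #_)
  open import Data.Fin.Properties using (_≟_; *↔×; all?; injective⇒≤)
  open import Data.Bool using (Bool; T; not; _∧_; _∨_; if_then_else_)
  open import Data.Unit using (tt)
  open import Data.Empty using (⊥-elim)
  open import Data.List.Membership.Propositional using (_∈_)
  open import Data.List.Relation.Unary.All using ([]; _∷_)
  open import Data.List.Relation.Unary.Unique.Propositional using (Unique; []; _∷_)
  open import Data.List.Relation.Unary.Unique.DecPropositional using (unique?)
  open import Data.Product using (Σ; _×_; _,_; proj₂)
  open import Data.Product.Properties using (≡-dec)
  open import Data.Sum using (_⊎_; inj₁; inj₂)
  open import Relation.Nullary using (¬_; Dec; yes; no)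
  open import Relation.Nullary.Decidable using (_×-dec_; toWitness)
  open import Relation.Binary.PropositionalEquality using (_≡_; _≢_; refl; sym; cong; subst)

  module _ (m : ℕ) where

    S : ℕ
    S = 13 + m

    Vertex : Set
    Vertex = Fin 3 × Fin S

    pattern X = zero
    pattern W₀ = suc zero
    pattern W₁ = suc (suc zero)

    adjB : Vertex → Vertex → Bool
    adjB (X , i) (X , j) = not (i == j)
    adjB (k , i) (l , j) = not (k == l) ∧ (i == j)

    looplessB : ∀ v → ¬ T (adjB v v)
    looplessB (X , i) i≠i = not⇒¬ i≠i (==-refl i)
    looplessB (W₀ , i) ()
    looplessB (W₁ , i) ()

    open Relabel Vertex (3 * S) (*↔× {3} {S}) adjB looplessB public
      renaming (D to B)

    sameIndexArc : ∀ k l i → k ≢ l → T (adjB (k , i) (l , i))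
    sameIndexArc X X i X≢X = ⊥-elim (X≢X refl)
    sameIndexArc X (suc l) i X≢l = ∧-intro (≢⇒/= X≢l) (==-refl i)
    sameIndexArc (suc k) l i k≢l = ∧-intro (≢⇒/= k≢l) (==-refl i)

    -- Colours are indices; the thirteen "fixed" colours are
    -- the first thirteen.
    fixed : Fin 13 → Fin S
    fixed c = c ↑ˡ m

    large : Fin m → Fin S
    large j = 13 ↑ʳ j

    byIndex : Fin 13 → Fin 13 → Fin S → Fin S
    byIndex usual belowSix i = if toℕ i <ᵇ 6 then fixed belowSix else fixed usual

    -- the arc X_i → X_j avoids the colours 12 and 8 of X₁₂, X₈ when possible
    cliqueColour : Fin S → Fin S → Fin S
    cliqueColour i j =
      if (i == fixed (# 12)) ∨ (j == fixed (# 12))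
      then (if (i == fixed (# 8)) ∨ (j == fixed (# 8)) then fixed (# 9) else fixed (# 8))
      else fixed (# 12)

    arcColourB : Vertex → Vertex → Fin S
    arcColourB (X , i) (X , j) = cliqueColour i j
    arcColourB (X , i) (W₁ , _) = byIndex (# 5) (# 11) i
    arcColourB (X , i) (_ , _) = byIndex (# 4) (# 10) i
    arcColourB (W₁ , i) (X , _) = byIndex (# 1) (# 7) i
    arcColourB (_ , i) (X , _) = byIndex (# 0) (# 6) i
    arcColourB (_ , i) (_ , _) = byIndex (# 2) (# 8) i

    vertexColourB : Vertex → Fin S
    vertexColourB (X , i) = i
    vertexColourB (_ , i) = byIndex (# 3) (# 9) i

    open Colouring arcColourB vertexColourB public

    -- Leaving w_i (w one of the W-kinds),
    -- the direct arc to X_i is taken unless its colour is j, the colour of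
    -- X_j; then the route goes round through the other W-kind w′.  Dually,
    -- arriving at w_j avoids an arc coloured i.
    leave : ∀ w w′ i (j : Fin S) → T (adjB (w , i) (X , i)) → T (adjB (w , i) (w′ , i)) →
            T (adjB (w′ , i) (X , i)) → Route (w , i) (X , i)
    leave w w′ i j wX ww′ w′X =
      if arcColourB (w , i) (X , i) == j
      then step (w′ , i) ww′ (step (X , i) w′X end)
      else step (X , i) wX end

    arrive : ∀ w w′ (i : Fin S) j → T (adjB (X , j) (w , j)) → T (adjB (X , j) (w′ , j)) →
             T (adjB (w′ , j) (w , j)) → Route (X , j) (w , j)
    arrive w w′ i j Xw Xw′ w′w =
      if arcColourB (X , j) (w , j) == i
      then step (w′ , j) Xw′ (step (w , j) w′w end)
      else step (w , j) Xw end

    exitRoute : ∀ k i (j : Fin S) → Route (k , i) (X , i)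
    exitRoute X i j = end
    exitRoute W₀ i j = leave W₀ W₁ i j (==-refl i) (==-refl i) (==-refl i)
    exitRoute W₁ i j = leave W₁ W₀ i j (==-refl i) (==-refl i) (==-refl i)

    entryRoute : ∀ k (i : Fin S) j → Route (X , j) (k , j)
    entryRoute X i j = end
    entryRoute W₀ i j = arrive W₀ W₁ i j (==-refl j) (==-refl j) (==-refl j)
    entryRoute W₁ i j = arrive W₁ W₀ i j (==-refl j) (==-refl j) (==-refl j)

    crossRoute : ∀ k l i j → T (not (i == j)) → Route (k , i) (l , j)
    crossRoute k l i j i≠j = exitRoute k i j ++ʳ step (X , j) i≠j (entryRoute l i j)

    Good : ∀ {u v} → Route u v → Set
    Good p = Unique (routeColours p) × Unique (routeVertices p)

    good? : ∀ {u v} (p : Route u v) → Dec (Good p)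
    good? p = unique? _≟_ (routeColours p) ×-dec unique? (≡-dec _≟_ _≟_) (routeVertices p)

    CrossGood : Fin S → Fin S → Set
    CrossGood i j = (i≠j : T (not (i == j))) → ∀ k l → Good (crossRoute k l i j i≠j)

    crossGood? : ∀ i j → Dec (CrossGood i j)
    crossGood? i j = ∀T? (not (i == j)) λ i≠j → all? λ k → all? λ l → good? (crossRoute k l i j i≠j)

    fixedFixed : ∀ a b → CrossGood (fixed a) (fixed b)
    fixedFixed = toWitness {a? = all? λ a → all? λ b → crossGood? (fixed a) (fixed b)} tt

    fixedLarge : ∀ b′ a → CrossGood (fixed a) (large b′)
    fixedLarge b′ = toWitness {a? = all? λ a → crossGood? (fixed a) (large b′)} tt

    largeFixed : ∀ a′ b → CrossGood (large a′) (fixed b)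
    largeFixed a′ = toWitness {a? = all? λ b → crossGood? (large a′) (fixed b)} tt

    -- For two large indices all routes are direct, and every required
    -- distinctness except i ≢ j holds between different constructors.
    apart : ∀ {i j : Fin S} {k l : Fin 3} → i ≢ j → (k , i) ≢ (l , j)
    apart i≢j e = i≢j (cong proj₂ e)

    largeLarge : ∀ a′ b′ (i≢j : large a′ ≢ large b′) → ∀ k l →
                 Good (crossRoute k l (large a′) (large b′) (≢⇒/= i≢j))
    largeLarge a′ b′ i≢j X X = [] ∷ [] , (apart i≢j ∷ []) ∷ [] ∷ []
    largeLarge a′ b′ i≢j X W₀ =
      ((λ ()) ∷ (λ ()) ∷ []) ∷ ((λ ()) ∷ []) ∷ [] ∷ [] ,
      (apart i≢j ∷ apart i≢j ∷ []) ∷ ((λ ()) ∷ []) ∷ [] ∷ []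
    largeLarge a′ b′ i≢j X W₁ =
      ((λ ()) ∷ (λ ()) ∷ []) ∷ ((λ ()) ∷ []) ∷ [] ∷ [] ,
      (apart i≢j ∷ apart i≢j ∷ []) ∷ ((λ ()) ∷ []) ∷ [] ∷ []
    largeLarge a′ b′ i≢j W₀ X =
      ((λ ()) ∷ (λ ()) ∷ []) ∷ ((λ ()) ∷ []) ∷ [] ∷ [] ,
      ((λ ()) ∷ apart i≢j ∷ []) ∷ (apart i≢j ∷ []) ∷ [] ∷ []
    largeLarge a′ b′ i≢j W₁ X =
      ((λ ()) ∷ (λ ()) ∷ []) ∷ ((λ ()) ∷ []) ∷ [] ∷ [] ,
      ((λ ()) ∷ apart i≢j ∷ []) ∷ (apart i≢j ∷ []) ∷ [] ∷ []
    largeLarge a′ b′ i≢j W₀ W₀ =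
      ((λ ()) ∷ (λ ()) ∷ (λ ()) ∷ (λ ()) ∷ []) ∷ ((λ ()) ∷ (λ ()) ∷ (λ ()) ∷ []) ∷
        ((λ ()) ∷ (λ ()) ∷ []) ∷ (i≢j ∷ []) ∷ [] ∷ [] ,
      ((λ ()) ∷ apart i≢j ∷ apart i≢j ∷ []) ∷ (apart i≢j ∷ apart i≢j ∷ []) ∷
        ((λ ()) ∷ []) ∷ [] ∷ []
    largeLarge a′ b′ i≢j W₀ W₁ =
      ((λ ()) ∷ (λ ()) ∷ (λ ()) ∷ (λ ()) ∷ []) ∷ ((λ ()) ∷ (λ ()) ∷ (λ ()) ∷ []) ∷
        ((λ ()) ∷ (λ ()) ∷ []) ∷ (i≢j ∷ []) ∷ [] ∷ [] ,
      ((λ ()) ∷ apart i≢j ∷ apart i≢j ∷ []) ∷ (apart i≢j ∷ apart i≢j ∷ []) ∷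
        ((λ ()) ∷ []) ∷ [] ∷ []
    largeLarge a′ b′ i≢j W₁ W₀ =
      ((λ ()) ∷ (λ ()) ∷ (λ ()) ∷ (λ ()) ∷ []) ∷ ((λ ()) ∷ (λ ()) ∷ (λ ()) ∷ []) ∷
        ((λ ()) ∷ (λ ()) ∷ []) ∷ (i≢j ∷ []) ∷ [] ∷ [] ,
      ((λ ()) ∷ apart i≢j ∷ apart i≢j ∷ []) ∷ (apart i≢j ∷ apart i≢j ∷ []) ∷
        ((λ ()) ∷ []) ∷ [] ∷ []
    largeLarge a′ b′ i≢j W₁ W₁ =
      ((λ ()) ∷ (λ ()) ∷ (λ ()) ∷ (λ ()) ∷ []) ∷ ((λ ()) ∷ (λ ()) ∷ (λ ()) ∷ []) ∷
        ((λ ()) ∷ (λ ()) ∷ []) ∷ (i≢j ∷ []) ∷ [] ∷ [] ,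
      ((λ ()) ∷ apart i≢j ∷ apart i≢j ∷ []) ∷ (apart i≢j ∷ apart i≢j ∷ []) ∷
        ((λ ()) ∷ []) ∷ [] ∷ []

    crossGood : ∀ i j (i≢j : i ≢ j) → ∀ k l → Good (crossRoute k l i j (≢⇒/= i≢j))
    crossGood i j i≢j with split {13} {m} i | split {13} {m} j
    ... | low a | low b = fixedFixed a b (≢⇒/= i≢j)
    ... | low a | high b′ = fixedLarge b′ a (≢⇒/= i≢j)
    ... | high a′ | low b = largeFixed a′ b (≢⇒/= i≢j)
    ... | high a′ | high b′ = largeLarge a′ b′ i≢j

    joinedᵛ : ∀ u v → u ≢ v →
              Σ (Route u v) λ p → IsPath (lower p) × TotalRainbow colouring (lower p)
    joinedᵛ (k , i) (l , j) u≢v with i ≟ j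
    ... | yes refl = p , lower-isPath p ((u≢v ∷ []) ∷ [] ∷ []) , lower-totalRainbow p ([] ∷ [])
      where
      p : Route (k , i) (l , i)
      p = step (l , i) (sameIndexArc k l i λ k≡l → u≢v (cong (_, i) k≡l)) end
    ... | no i≢j with crossGood i j i≢j k l
    ...   | colours , vertices =
            crossRoute k l i j (≢⇒/= i≢j) ,
            lower-isPath (crossRoute k l i j (≢⇒/= i≢j)) vertices ,
            lower-totalRainbow (crossRoute k l i j (≢⇒/= i≢j)) colours

    paths : Connects B (TotalRainbow colouring)
    paths = connectsᵛ _ joinedᵛ

    -- Lower bound.  The region {W₀_i, W₁_i} is left only through X_i and
    -- entered only from X_i, so a path from W₀_i to W₀_j (i ≢ j) has both
    -- X_i and X_j as internal vertices.
    inRegion : Fin S → Vertex → Bool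
    inRegion i (k , j) = not (k == X) ∧ (j == i)


    leavesRegion : ∀ i a b → T (adjB a b) → T (inRegion i a) → T (inRegion i b) ⊎ b ≡ (X , i)
    leavesRegion i (suc k , i₁) (l , j₁) ab inR
      with ==-sound {i = i₁} {j₁} (proj₂ (∧-elim {not (suc k == l)} ab)) | ==-sound {i = i₁} {i} inR
    leavesRegion i (suc k , .i) (X , .i) ab inR | refl | refl = inj₂ refl
    leavesRegion i (suc k , .i) (suc l , .i) ab inR | refl | refl = inj₁ (==-refl i)

    entersRegion : ∀ i a b → T (adjB a b) → T (inRegion i b) → T (inRegion i a) ⊎ a ≡ (X , i)
    entersRegion i (X , i₁) (suc l , j₁) ab inR with ==-sound {i = i₁} {j₁} ab | ==-sound {i = j₁} {i} inR
    ... | refl | refl = inj₂ refl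
    entersRegion i (suc k , i₁) (suc l , j₁) ab inR
      with ==-sound {i = i₁} {j₁} (proj₂ (∧-elim {not (suc k == suc l)} ab)) | ==-sound {i = j₁} {i} inR
    ... | refl | refl = inj₁ (==-refl i)

    module _ {k : ℕ} (col : VertexColouring B k) (C : Connects B (VertexRainbow col)) where

      cliqueColours-distinct : ∀ i j → i ≢ j → col (enc (X , i)) ≢ col (enc (X , j))
      cliqueColours-distinct i j i≢j with C (enc (W₀ , i)) (enc (W₀ , j)) (enc-≢ (apart {k = W₀} {l = W₀} i≢j))
      ... | p , _ , rainbow = unique-map-≢ col rainbow Xi∈p Xj∈p (enc-≢ (apart {k = X} {l = X} i≢j))
        where
        inside : ∀ i → T (inRegion i (dec (enc (W₀ , i))))
        inside i = subst (λ v → T (inRegion i v)) (sym (dec-enc (W₀ , i))) (==-refl i)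

        outside : ∀ i j → i ≢ j → ¬ T (inRegion i (dec (enc (W₀ , j))))
        outside i j i≢j h = i≢j (sym (==-sound {i = j} {i} (subst (λ v → T (inRegion i v)) (dec-enc (W₀ , j)) h)))

        notEnd : ∀ i j → enc (X , i) ≢ enc (W₀ , j)
        notEnd i j = enc-≢ {X , i} {W₀ , j} λ ()

        Xi∈p : enc (X , i) ∈ internal p
        Xi∈p = ∈internal p (leaves-throughᵛ (inRegion i) (X , i) (leavesRegion i) p (inside i) (outside i j i≢j))
                           (notEnd i i) (notEnd i j)

        Xj∈p : enc (X , j) ∈ internal p
        Xj∈p = ∈internal p (enters-throughᵛ (inRegion j) (X , j) (entersRegion j) p
                             (outside j i λ e → i≢j (sym e)) (inside j))
                           (notEnd j i) (notEnd j j)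

      vertexLowerBound : S ≤ k
      vertexLowerBound = injective⇒≤ {f = λ i → col (enc (X , i))} injective
        where
        injective : ∀ {i j} → col (enc (X , i)) ≡ col (enc (X , j)) → i ≡ j
        injective {i} {j} e with i ≟ j
        ... | yes i≡j = i≡j
        ... | no i≢j = ⊥-elim (cliqueColours-distinct i j i≢j e)

  partB : (s : ℕ) → 13 ≤ s → Σ Digraph λ D → StronglyConnected D × trc D s × rvc D s
  partB s 13≤s =
    subst (λ s → Σ Digraph λ D → StronglyConnected D × trc D s × rvc D s) (m+[n∸m]≡n 13≤s)
    ( B m
    , connects⇒stronglyConnected (paths m)
    , ((colouring m , paths m) , λ { k ((ca , cv) , C) →
        vertexLowerBound m cv (connects-map (totalRainbow⇒vertexRainbow ca cv) C) })
    , ((vertexColour m , connects-map (totalRainbow⇒vertexRainbow (arcColour m) (vertexColour m)) (paths m))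
      , λ { k (col , C) → vertexLowerBound m col C })
    )
    where
    m : ℕ
    m = s ∸ 13

module PartC where

  open import Defs
  open Parameters
  open Evaluation
  open import Data.Nat using (ℕ; suc; _+_; _*_; _∸_; _≤_; z≤n; s≤s)
  open import Data.Nat.Properties using (m+[n∸m]≡n)
  open import Data.Fin using (Fin; zero; suc; _↑ˡ_; _↑ʳ_; combine; remQuot; #_)
  open import Data.Fin.Properties using (_≟_; all?; injective⇒≤; remQuot-combine; combine-remQuot)
  open import Data.Bool using (Bool; true; false; T; not; _∧_; _∨_; if_then_else_)
  open import Data.Maybe using (Maybe; just; nothing)
  open import Data.Unit using (tt)
  open import Data.Empty using (⊥-elim)
  open import Data.List using ([]; _∷_; map)
  open import Data.List.Relation.Unary.All using ([]; _∷_)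
  open import Data.List.Relation.Unary.Unique.Propositional using (Unique; []; _∷_)
  open import Data.List.Relation.Unary.Unique.DecPropositional using (unique?)
  open import Data.Product using (Σ; _×_; _,_; proj₁; proj₂; uncurry)
  open import Data.Sum using (_⊎_; inj₁; inj₂)
  open import Function.Bundles using (_↔_; mk↔ₛ′)
  open import Relation.Nullary using (¬_; Dec; yes; no)
  open import Relation.Nullary.Decidable using (_×-dec_; _⊎-dec_; _→-dec_; T?; toWitness)
  open import Relation.Binary.PropositionalEquality
    using (_≡_; _≢_; refl; sym; trans; cong; subst; subst₂)

  -- The X_i form a complete digraph, X_i ↔ Z,
  -- Z → U_i, V_i → Z, U_i → X_i → V_i, and U_i → V_j unless (i, j) is a
  -- forced pair, in which case U_i X_i X_j V_j is the only U_i–V_j geodesic.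
  module _ (m : ℕ) where

    S : ℕ
    S = 13 + m

    Vertex : Set
    Vertex = Maybe (Fin 3 × Fin S)

    pattern Z = nothing
    pattern X i = just (zero , i)
    pattern U i = just (suc zero , i)
    pattern V i = just (suc (suc zero) , i)

    code : Fin (suc (3 * S)) ↔ Vertex
    code = mk↔ₛ′ to from to-from from-to
      where
      to : Fin (suc (3 * S)) → Vertex
      to zero = nothing
      to (suc x) = just (remQuot S x)

      from : Vertex → Fin (suc (3 * S))
      from nothing = zero
      from (just v) = suc (uncurry combine v)

      to-from : ∀ v → to (from v) ≡ v
      to-from nothing = refl
      to-from (just (k , i)) = cong just (remQuot-combine k i)

      from-to : ∀ x → from (to x) ≡ x
      from-to zero = refl
      from-to (suc x) = cong suc (combine-remQuot {3} S x)

    -- Colours are indices; the first thirteen are the fixed ones.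
    fixed : Fin 13 → Fin S
    fixed c = c ↑ˡ m

    large : Fin m → Fin S
    large j = 13 ↑ʳ j

    -- colours of the arcs U_i → X_i and X_j → V_j: fixed colours avoiding i, j
    upColour : Fin S → Fin S
    upColour i =
      if i == fixed (# 0) then fixed (# 1) else (if i == fixed (# 1) then fixed (# 2) else fixed (# 0))

    downColour : Fin S → Fin S
    downColour j =
      if j == fixed (# 3) then fixed (# 4) else (if j == fixed (# 4) then fixed (# 5) else fixed (# 3))

    -- (i, j) is forced when the route U_i X_i X_j V_j can be rainbow
    Forced : Fin S → Fin S → Bool
    Forced i j = not (j == i) ∧ (not (j == upColour i) ∧ not (i == downColour j))

    adjC : Vertex → Vertex → Bool
    adjC (X i) (X j) = not (i == j)
    adjC (U i) (X j) = i == j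
    adjC (X i) (V j) = i == j
    adjC (U i) (V j) = not (Forced i j)
    adjC (V _) Z = true
    adjC Z (X _) = true
    adjC Z (U _) = true
    adjC (X _) Z = true
    adjC _ _ = false

    looplessC : ∀ v → ¬ T (adjC v v)
    looplessC (X i) i≠i = not⇒¬ i≠i (==-refl i)
    looplessC (U i) ()
    looplessC (V i) ()
    looplessC Z ()

    open Relabel Vertex (suc (3 * S)) code adjC looplessC public
      renaming (D to C)

    -- the arc X_i → X_j avoids the colours 6 and 7 of X₆, X₇ when possible
    cliqueColour : Fin S → Fin S → Fin S
    cliqueColour i j =
      if (i == fixed (# 6)) ∨ (j == fixed (# 6))
      then (if (i == fixed (# 7)) ∨ (j == fixed (# 7)) then fixed (# 8) else fixed (# 7))
      else fixed (# 6)

    arcColourC : Vertex → Vertex → Fin S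
    arcColourC (X i) (X j) = cliqueColour i j
    arcColourC (U i) (X _) = upColour i
    arcColourC (X i) (V _) = downColour i
    arcColourC (V _) Z = fixed (# 2)
    arcColourC Z (U _) = fixed (# 4)
    arcColourC _ _ = fixed (# 0)

    vertexColourC : Vertex → Fin S
    vertexColourC (X i) = i
    vertexColourC Z = fixed (# 3)
    vertexColourC _ = fixed (# 1)

    open Colouring arcColourC vertexColourC public

    notForced-self : ∀ k → T (adjC (U k) (V k))
    notForced-self k = ¬⇒not λ forced → not⇒¬ (proj₁ (∧-elim {not (k == k)} forced)) (==-refl k)

    forced⇒≢ : ∀ {i j} → T (Forced i j) → i ≢ j
    forced⇒≢ {i} {j} forced refl = not⇒¬ (proj₁ (∧-elim {not (i == i)} forced)) (==-refl i)

    upRoute : ∀ i j → T (not (i == j)) → Route (U i) (X j)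
    upRoute i j i≠j = step (X i) (==-refl i) (step (X j) i≠j end)

    downRoute : ∀ i j → T (not (i == j)) → Route (X i) (V j)
    downRoute i j i≠j = step (X j) i≠j (step (V j) (==-refl j) end)

    forcedRoute : ∀ i j → T (not (i == j)) → Route (U i) (V j)
    forcedRoute i j i≠j = step (X i) (==-refl i) (step (X j) i≠j (step (V j) (==-refl j) end))

    CrossFacts : Fin S → Fin S → Set
    CrossFacts i j = (i≠j : T (not (i == j))) →
      Unique (routeColours (upRoute i j i≠j)) × Unique (routeColours (downRoute i j i≠j)) ×
      (T (Forced i j) → Unique (routeColours (forcedRoute i j i≠j))) × (T (Forced i j) ⊎ T (Forced j i))

    crossFacts? : ∀ i j → Dec (CrossFacts i j)
    crossFacts? i j = ∀T? (not (i == j)) λ i≠j →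
      unique? _≟_ (routeColours (upRoute i j i≠j)) ×-dec unique? _≟_ (routeColours (downRoute i j i≠j)) ×-dec
      (T? (Forced i j) →-dec unique? _≟_ (routeColours (forcedRoute i j i≠j))) ×-dec
      (T? (Forced i j) ⊎-dec T? (Forced j i))

    fixedFixed : ∀ a b → CrossFacts (fixed a) (fixed b)
    fixedFixed = toWitness {a? = all? λ a → all? λ b → crossFacts? (fixed a) (fixed b)} tt

    fixedLarge : ∀ b′ a → CrossFacts (fixed a) (large b′)
    fixedLarge b′ = toWitness {a? = all? λ a → crossFacts? (fixed a) (large b′)} tt

    largeFixed : ∀ a′ b → CrossFacts (large a′) (fixed b)
    largeFixed a′ = toWitness {a? = all? λ b → crossFacts? (large a′) (fixed b)} tt

    -- For two large indices all route colours except i and j are fixed.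
    largeLarge : ∀ a′ b′ (i≢j : large a′ ≢ large b′) → CrossFacts (large a′) (large b′)
    largeLarge a′ b′ i≢j _ =
      ((λ ()) ∷ (λ ()) ∷ []) ∷ ((λ ()) ∷ []) ∷ [] ∷ [] ,
      ((λ ()) ∷ (λ ()) ∷ []) ∷ ((λ ()) ∷ []) ∷ [] ∷ [] ,
      (λ _ → ((λ ()) ∷ (λ ()) ∷ (λ ()) ∷ (λ ()) ∷ []) ∷ ((λ ()) ∷ (λ ()) ∷ (λ ()) ∷ []) ∷
             ((λ ()) ∷ (λ ()) ∷ []) ∷ (i≢j ∷ []) ∷ [] ∷ []) ,
      inj₁ (∧-intro (≢⇒/= λ j≡i → i≢j (sym j≡i)) tt)

    crossFacts : ∀ i j (i≢j : i ≢ j) → CrossFacts i j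
    crossFacts i j i≢j with split {13} {m} i | split {13} {m} j
    ... | low a | low b = fixedFixed a b
    ... | low a | high b′ = fixedLarge b′ a
    ... | high a′ | low b = largeFixed a′ b
    ... | high a′ | high b′ = largeLarge a′ b′ i≢j

    upRainbow : ∀ i j (i≢j : i ≢ j) → Unique (routeColours (upRoute i j (≢⇒/= i≢j)))
    upRainbow i j i≢j = proj₁ (crossFacts i j i≢j (≢⇒/= i≢j))

    downRainbow : ∀ i j (i≢j : i ≢ j) → Unique (routeColours (downRoute i j (≢⇒/= i≢j)))
    downRainbow i j i≢j = proj₁ (proj₂ (crossFacts i j i≢j (≢⇒/= i≢j)))

    forcedRainbow : ∀ i j (i≢j : i ≢ j) → T (Forced i j) → Unique (routeColours (forcedRoute i j (≢⇒/= i≢j)))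
    forcedRainbow i j i≢j = proj₁ (proj₂ (proj₂ (crossFacts i j i≢j (≢⇒/= i≢j))))

    someForced : ∀ i j → i ≢ j → T (Forced i j) ⊎ T (Forced j i)
    someForced i j i≢j = proj₂ (proj₂ (proj₂ (crossFacts i j i≢j (≢⇒/= i≢j))))

    three≤UU : ∀ {i k} → i ≢ k → (q : Route (U i) (U k)) → 3 ≤ routeLength q
    three≤UU i≢k end = ⊥-elim (i≢k refl)
    three≤UU _ (step _ () end)
    three≤UU _ (step (X _) _ (step _ () end))
    three≤UU _ (step (V _) _ (step _ () end))
    three≤UU _ (step Z () _)
    three≤UU _ (step (U _) () _)
    three≤UU _ (step _ _ (step _ _ (step _ _ _))) = s≤s (s≤s (s≤s z≤n))

    three≤VV : ∀ {j k} → j ≢ k → (q : Route (V j) (V k)) → 3 ≤ routeLength q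
    three≤VV j≢k end = ⊥-elim (j≢k refl)
    three≤VV _ (step _ () end)
    three≤VV _ (step Z _ (step _ () end))
    three≤VV _ (step (X _) () _)
    three≤VV _ (step (U _) () _)
    three≤VV _ (step (V _) () _)
    three≤VV _ (step _ _ (step _ _ (step _ _ _))) = s≤s (s≤s (s≤s z≤n))

    three≤UV : ∀ {i j} → T (Forced i j) → (q : Route (U i) (V j)) → 3 ≤ routeLength q
    three≤UV forced (step _ notForced end) = ⊥-elim (not⇒¬ notForced forced)
    three≤UV {i} {j} forced (step (X a) ia (step _ aj end))
      with ==-sound {i = i} {a} ia | ==-sound {i = a} {j} aj
    ... | refl | refl = ⊥-elim (forced⇒≢ {i} {i} forced refl)
    three≤UV _ (step (V _) _ (step _ () end))
    three≤UV _ (step Z () _)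
    three≤UV _ (step (U _) () _)
    three≤UV _ (step _ _ (step _ _ (step _ _ _))) = s≤s (s≤s (s≤s z≤n))

    throughClique : ∀ {i j} → T (Forced i j) → (q : Route (U i) (V j)) → routeLength q ≤ 3 →
                    routeInternal q ≡ X i ∷ X j ∷ []
    throughClique {i} {j} forced (step (X a) ia (step (X b) _ (step _ bj end))) _
      with ==-sound {i = i} {a} ia | ==-sound {i = b} {j} bj
    ... | refl | refl = refl
    throughClique _ (step (X _) _ (step (V _) _ (step _ () end))) _
    throughClique _ (step (X _) _ (step Z _ (step _ () end))) _
    throughClique _ (step (X _) _ (step (U _) () _)) _
    throughClique _ (step (V _) _ (step Z _ (step _ () end))) _
    throughClique _ (step (V _) _ (step (X _) () _)) _
    throughClique _ (step (V _) _ (step (U _) () _)) _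
    throughClique _ (step (V _) _ (step (V _) () _)) _
    throughClique _ (step Z () _) _
    throughClique _ (step (U _) () _) _
    throughClique _ (step _ _ (step _ _ (step _ _ (step _ _ _)))) (s≤s (s≤s (s≤s ())))
    throughClique forced q@(step _ _ end) _ with three≤UV forced q
    ... | s≤s ()
    throughClique forced q@(step _ _ (step _ _ end)) _ with three≤UV forced q
    ... | s≤s (s≤s ())

    apart : ∀ {k l : Fin 3} {i j : Fin S} → i ≢ j → just (k , i) ≢ just (l , j)
    apart i≢j refl = i≢j refl

    forcedRoute-vertices : ∀ {i j} → i ≢ j → (i≠j : T (not (i == j))) →
                           Unique (routeVertices (forcedRoute i j i≠j))
    forcedRoute-vertices i≢j _ =
      ((λ ()) ∷ (λ ()) ∷ (λ ()) ∷ []) ∷ (apart i≢j ∷ (λ ()) ∷ []) ∷ ((λ ()) ∷ []) ∷ [] ∷ []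

    Joined : Vertex → Vertex → Set
    Joined u v = Σ (Route u v) λ p → IsGeodesic (lower p) × TotalRainbow colouring (lower p)

    arcJ : ∀ {u v} → u ≢ v → (uv : T (adjC u v)) → Joined u v
    arcJ {u} {v} u≢v uv = step v uv end , arc-geodesicᵛ u≢v uv , lower-totalRainbow {u} (step v uv end) ([] ∷ [])

    twoArcJ : ∀ {u v} w → u ≢ w → u ≢ v → w ≢ v → (uw : T (adjC u w)) (wv : T (adjC w v)) →
              ¬ T (adjC u v) → Unique (routeColours {u} (step w uw (step v wv end))) → Joined u v
    twoArcJ {u} {v} w u≢w u≢v w≢v uw wv ¬uv colours =
      step w uw (step v wv end) , twoArc-geodesicᵛ w u≢w u≢v w≢v uw wv ¬uv ,
      lower-totalRainbow {u} (step w uw (step v wv end)) colours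

    threeArcJ : ∀ {u v} (p : Route u v) → Unique (routeVertices p) →
                (∀ q → routeLength p ≤ routeLength q) → Unique (routeColours p) → Joined u v
    threeArcJ p vertices shortest colours = p , lower-geodesic p vertices shortest , lower-totalRainbow p colours

    joinedᵛ : ∀ u v → u ≢ v → Joined u v
    joinedᵛ Z Z Z≢Z = ⊥-elim (Z≢Z refl)
    joinedᵛ Z (X k) _ = arcJ (λ ()) tt
    joinedᵛ Z (U k) _ = arcJ (λ ()) tt
    joinedᵛ Z (V k) _ = twoArcJ (U k) (λ ()) (λ ()) (λ ()) tt (notForced-self k) (λ ()) distinct
    joinedᵛ (X i) Z _ = arcJ (λ ()) tt
    joinedᵛ (X i) (X k) Xi≢Xk = arcJ Xi≢Xk (≢⇒/= λ i≡k → Xi≢Xk (cong (λ k → X k) i≡k))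
    joinedᵛ (X i) (U k) _ = twoArcJ Z (λ ()) (λ ()) (λ ()) tt tt (λ ()) distinct
    joinedᵛ (X i) (V j) Xi≢Vj with i ≟ j
    ... | yes refl = arcJ Xi≢Vj (==-refl i)
    ... | no i≢j = twoArcJ (X j) (apart i≢j) (λ ()) (λ ()) (≢⇒/= i≢j) (==-refl j)
                     (λ i=j → i≢j (==-sound i=j)) (downRainbow i j i≢j)
    joinedᵛ (U i) Z _ = twoArcJ (V i) (λ ()) (λ ()) (λ ()) (notForced-self i) tt (λ ()) distinct
    joinedᵛ (U i) (X k) Ui≢Xk with i ≟ k
    ... | yes refl = arcJ Ui≢Xk (==-refl i)
    ... | no i≢k = twoArcJ (X i) (λ ()) Ui≢Xk (apart i≢k) (==-refl i) (≢⇒/= i≢k)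
                     (λ i=k → i≢k (==-sound i=k)) (upRainbow i k i≢k)
    joinedᵛ (U i) (U k) Ui≢Uk =
      threeArcJ (step (V i) (notForced-self i) (step Z tt (step (U k) tt end)))
        (((λ ()) ∷ (λ ()) ∷ Ui≢Uk ∷ []) ∷ ((λ ()) ∷ (λ ()) ∷ []) ∷ ((λ ()) ∷ []) ∷ [] ∷ [])
        (three≤UU λ i≡k → Ui≢Uk (cong (λ k → U k) i≡k)) distinct
    joinedᵛ (U i) (V j) Ui≢Vj with T? (Forced i j)
    ... | no notForced = arcJ Ui≢Vj (¬⇒not notForced)
    ... | yes forced =
      threeArcJ (forcedRoute i j (≢⇒/= i≢j)) (forcedRoute-vertices i≢j (≢⇒/= i≢j))
        (three≤UV forced) (forcedRainbow i j i≢j forced)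
      where
      i≢j : i ≢ j
      i≢j = forced⇒≢ forced
    joinedᵛ (V j) Z _ = arcJ (λ ()) tt
    joinedᵛ (V j) (X k) _ = twoArcJ Z (λ ()) (λ ()) (λ ()) tt tt (λ ()) distinct
    joinedᵛ (V j) (U k) _ = twoArcJ Z (λ ()) (λ ()) (λ ()) tt tt (λ ()) distinct
    joinedᵛ (V j) (V k) Vj≢Vk =
      threeArcJ (step Z tt (step (U k) tt (step (V k) (notForced-self k) end)))
        (((λ ()) ∷ (λ ()) ∷ Vj≢Vk ∷ []) ∷ ((λ ()) ∷ (λ ()) ∷ []) ∷ ((λ ()) ∷ []) ∷ [] ∷ [])
        (three≤VV λ j≡k → Vj≢Vk (cong (λ k → V k) j≡k)) distinct

    geodesics : GeoConnects C (TotalRainbow colouring)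
    geodesics = connectsᵛ _ joinedᵛ

    -- For a forced pair (i, j) a shortest U_i–V_j walk has
    -- internal vertices exactly X_i, X_j, so they get different colours; and
    -- of any two different indices one ordered pair is forced.
    module _ {k : ℕ} (col : VertexColouring C k) (G : GeoConnects C (VertexRainbow col)) where

      ends-distinct : ∀ xs {a b} → map dec xs ≡ a ∷ b ∷ [] → Unique (map col xs) → col (enc a) ≢ col (enc b)
      ends-distinct (x ∷ y ∷ []) refl ((cx≢cy ∷ []) ∷ _) =
        subst₂ (λ x′ y′ → col x′ ≢ col y′) (sym (enc-dec x)) (sym (enc-dec y)) cx≢cy

      forcedColours : ∀ i j → T (Forced i j) → col (enc (X i)) ≢ col (enc (X j))
      forcedColours i j forced with G (enc (U i)) (enc (V j)) (enc-≢ {U i} {V j} λ ())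
      ... | p , (_ , shortest) , rainbow with raiseAt p
      ...   | r , r≡p , r-internal =
        ends-distinct (internal p) (trans (sym r-internal) (throughClique forced r r≤3)) rainbow
        where
        i≠j : T (not (i == j))
        i≠j = ≢⇒/= (forced⇒≢ forced)

        r≤3 : routeLength r ≤ 3
        r≤3 = subst₂ _≤_ (sym r≡p) (lower-length (forcedRoute i j i≠j))
                (shortest (lower (forcedRoute i j i≠j))
                          (lower-isPath (forcedRoute i j i≠j) (forcedRoute-vertices (forced⇒≢ forced) i≠j)))

      vertexLowerBound : S ≤ k
      vertexLowerBound = injective⇒≤ {f = λ i → col (enc (X i))} injective
        where
        injective : ∀ {i j} → col (enc (X i)) ≡ col (enc (X j)) → i ≡ j
        injective {i} {j} same with i ≟ j
        ... | yes i≡j = i≡j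
        ... | no i≢j with someForced i j i≢j
        ...   | inj₁ forced = ⊥-elim (forcedColours i j forced same)
        ...   | inj₂ forced = ⊥-elim (forcedColours j i forced (sym same))

  partC : (s : ℕ) → 13 ≤ s → Σ Digraph λ D → StronglyConnected D × strc D s × srvc D s
  partC s 13≤s =
    subst (λ s → Σ Digraph λ D → StronglyConnected D × strc D s × srvc D s) (m+[n∸m]≡n 13≤s)
    ( C m
    , connects⇒stronglyConnected (geoConnects⇒connects (geodesics m))
    , ((colouring m , geodesics m) , λ { k ((ca , cv) , G) →
        vertexLowerBound m cv (geoConnects-map (totalRainbow⇒vertexRainbow ca cv) G) })
    , ((vertexColour m , geoConnects-map (totalRainbow⇒vertexRainbow (arcColour m) (vertexColour m)) (geodesics m))
      , λ { k (col , G) → vertexLowerBound m col G })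
    )
    where
    m : ℕ
    m = s ∸ 13

theorem7 : ((N : ℕ) → Σ Digraph λ D →
    N ≤ n D × StronglyConnected D × trc D 3 × strc D 3 × rc D 3 × src D 3)
    × ((s : ℕ) → 13 ≤ s → Σ Digraph λ D → StronglyConnected D × trc D s × rvc D s)
    × ((s : ℕ) → 13 ≤ s → Σ Digraph λ D → StronglyConnected D × strc D s × srvc D s)
theorem7 = PartA.partA , PartB.partB , PartC.partC
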